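{- Let $p\ge1$, $d=4p+3$, $\pi=0\diamondsuit0\diamondsuit$, and for $1\le j\le p$ let $\beta_j=11\,\pi^{p-1}\,0\,\diamondsuit^{4j+1}\,000\,\diamondsuit^{d}$. A solid binary string $S\approx 11\pi^p0$ is a cover of each partial word $\beta_j$ for $j=1,\ldots,p$ if and only if $S=11h(V)0$ for some binary partial word $V$ of length $p$, where $h$ is the morphism $h(0)=0100$, $h(1)=0001$, $h(\diamondsuit)=0000$.
   Context: Binary partial words are strings over $\{0,1,\diamondsuit\}$, where $\diamondsuit$ is a don't care symbol matching both $0$ and $1$; a solid string contains no $\diamondsuit$. Two partial words $U,V$ match ($U\approx V$) if $|U|=|V|$ and for each $i$, $U[i]=V[i]$ or one of them is $\diamondsuit$. Exponents denote repetition. A solid string $S$ occurs in a partial word $T$ at position $j$ if $S\approx T[j..j+|S|-1]$; $S$ covers $T$ if every position $i$ of $T$ lies inside some occurrence of $S$ (an occurrence starting in $\{i-|S|+1,\ldots,i\}$). -}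

module Defs where

open import Data.Bool using (Bool; true; false)
open import Data.Nat using (ℕ; _+_; _*_; _∸_; _≤_; _<_)
open import Data.List using (List; []; _∷_; _++_; length; map; concat; concatMap; replicate; take; drop)
open import Data.List.Relation.Binary.Pointwise using (Pointwise)
open import Data.Product using (∃; _×_)

data PSym : Set where
  𝟎 𝟏 ◇ : PSym

PWord : Set
PWord = List PSym

toSym : Bool → PSym
toSym false = 𝟎
toSym true  = 𝟏

solid : List Bool → PWord
solid = map toSym

data SymMatch : PSym → PSym → Set where
  refl0 : SymMatch 𝟎 𝟎
  refl1 : SymMatch 𝟏 𝟏
  holeˡ : ∀ {b} → SymMatch ◇ b
  holeʳ : ∀ {a} → SymMatch a ◇

_≈ₚ_ : PWord → PWord → Set
U ≈ₚ V = Pointwise SymMatch U V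

OccursAt : List Bool → PWord → ℕ → Set
OccursAt S T j = solid S ≈ₚ take (length S) (drop j T)

Covers : List Bool → PWord → Set
Covers S T = ∀ i → i < length T →
  ∃ λ k → k ≤ i × i < k + length S × OccursAt S T k

pow : ℕ → PWord → PWord
pow n w = concat (replicate n w)

π : PWord
π = 𝟎 ∷ ◇ ∷ 𝟎 ∷ ◇ ∷ []

d : ℕ → ℕ
d p = 4 * p + 3

pattern11π0 : ℕ → PWord
pattern11π0 p = 𝟏 ∷ 𝟏 ∷ pow p π ++ 𝟎 ∷ []

β : ℕ → ℕ → PWord
β p j = 𝟏 ∷ 𝟏 ∷ pow (p ∸ 1) π ++ 𝟎 ∷ replicate (4 * j + 1) ◇
        ++ 𝟎 ∷ 𝟎 ∷ 𝟎 ∷ replicate (d p) ◇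

h : PSym → List Bool
h 𝟎 = false ∷ true ∷ false ∷ false ∷ []
h 𝟏 = false ∷ false ∷ false ∷ true ∷ []
h ◇ = false ∷ false ∷ false ∷ false ∷ []

hWord : PWord → List Bool
hWord = concatMap h

-- S ≈ 11π^p0 forces S = 11 B₁ ⋯ B_p 0 with blocks B_i = 0a0b, and S = 11h(V)0 exactly when no
-- block is 0101, since h maps 0, 1, ◇ onto the other three blocks. The occurrence of S at 0 covers β_j up to position |S| - 1. No occurrence starts
-- between 0 and the gap, because there any two consecutive symbols of β_j contain a solid 0
-- while S starts with 11. So position |S| can only be covered by an occurrence starting at most
-- four symbols into the gap, and the gap length 4j+1 makes each of these lay the 000 of β_j
-- over block j and its neighbouring symbols. If B_j = 0101, every such placement puts a 1 on
-- the 000; otherwise the 000 fits on 0a0 or on 0b0, and that occurrence, followed by the one at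
-- the start of the final ◇^d, covers the rest of β_j.
module Submission where

open import Defs
open import Data.Bool using (Bool; true; false)
open import Data.Nat using (ℕ; zero; suc; _+_; _*_; _∸_; _≤_; _<_; z≤n; s≤s; _≤?_; _<?_)
open import Data.Nat.Properties
  using (≤-refl; ≤-trans; ≤-reflexive; n≤1+n; m≤n+m; ≤-pred; <-irrefl; <-≤-trans; ≰⇒>; ≮⇒≥; suc-injective;
         +-comm; +-monoʳ-≤; +-monoˡ-≤; *-monoˡ-≤; ∸-monoˡ-≤; ∸-monoʳ-≤; m∸n≤m; m<m+n; m+n∸m≡n; m+[n∸m]≡n;
         module ≤-Reasoning)
open import Data.Nat.Tactic.RingSolver using (solve-∀)
open import Data.List using (List; []; _∷_; _++_; length; map; concatMap; replicate; take; drop)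
open import Data.List.Properties
  using (length-++; length-map; length-replicate; ++-assoc; concatMap-++; concatMap-map; concatMap-cong; drop-drop)
open import Data.List.Relation.Binary.Pointwise using ([]; _∷_)
open import Data.List.Relation.Unary.All as All using (All; []; _∷_)
open import Data.List.Relation.Unary.All.Properties using (map⁺; ++⁻ʳ)
open import Data.List.Membership.Propositional.Properties using (∈-∃++)
open import Data.Product using (∃; ∃₂; _×_; _,_)
open import Data.Empty using (⊥-elim)
open import Function.Bundles using (_⇔_; mk⇔; Equivalence)
open import Relation.Nullary using (¬_; yes; no)
open import Relation.Binary.PropositionalEquality
  using (_≡_; _≢_; refl; sym; trans; cong; subst; subst₂; module ≡-Reasoning)

module _ {A : Set} where

  length-prefix-< : ∀ (xs : List A) {x ys} → length xs < length (xs ++ x ∷ ys)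
  length-prefix-< []       = s≤s z≤n
  length-prefix-< (y ∷ xs) = s≤s (length-prefix-< xs)

  split-at : ∀ (xs : List A) n → n < length xs → ∃ λ ys → ∃₂ λ x zs → xs ≡ ys ++ x ∷ zs × length ys ≡ n
  split-at (x ∷ xs) zero    _        = [] , x , xs , refl , refl
  split-at (x ∷ xs) (suc n) (s≤s n<) with split-at xs n n<
  ... | ys , y , zs , refl , refl = x ∷ ys , y , zs , refl , refl

  drop-replicate-++ : ∀ m k {x : A} ys → drop (m + k) (replicate m x ++ ys) ≡ drop k ys
  drop-replicate-++ zero    k ys = refl
  drop-replicate-++ (suc m) k ys = drop-replicate-++ m k ys

  drop-replicate-++-≤ : ∀ {t m} {x : A} ys → t ≤ m → drop t (replicate m x ++ ys) ≡ replicate (m ∸ t) x ++ ys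
  drop-replicate-++-≤         ys z≤n       = refl
  drop-replicate-++-≤ {suc t} ys (s≤s t≤m) = drop-replicate-++-≤ ys t≤m

  length-via-drop : ∀ k (xs : List A) {y ys} → drop k xs ≡ y ∷ ys → length xs ≡ k + length (y ∷ ys)
  length-via-drop zero    xs       eq = cong length eq
  length-via-drop (suc k) (x ∷ xs) eq = cong suc (length-via-drop k xs eq)

_⊑_ : List Bool → PWord → Set
S ⊑ W = solid S ≈ₚ take (length S) W

⊑-◇ : ∀ S {N} → length S ≤ N → S ⊑ replicate N ◇
⊑-◇ []      _           = []
⊑-◇ (b ∷ S) (s≤s |S|≤N) = holeʳ ∷ ⊑-◇ S |S|≤N

⊑-zeros : ∀ A {m B N} → length A ≡ m → length (A ++ false ∷ false ∷ false ∷ B) ≤ N →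
          (A ++ false ∷ false ∷ false ∷ B) ⊑ (replicate m ◇ ++ 𝟎 ∷ 𝟎 ∷ 𝟎 ∷ replicate N ◇)
⊑-zeros []      {B = B} refl |S|≤N = refl0 ∷ refl0 ∷ refl0 ∷ ⊑-◇ B (≤-trans (m≤n+m (length B) 3) |S|≤N)
⊑-zeros (a ∷ A)         refl |S|≤N = holeʳ ∷ ⊑-zeros A refl (≤-trans (n≤1+n _) |S|≤N)

-- Any two consecutive symbols of x π^q 0 contain a solid 0.
ones-⋢-π : ∀ q m x {R X} → m ≤ q * 4 + 1 → ¬ (true ∷ true ∷ R) ⊑ drop m (x ∷ pow q π ++ 𝟎 ∷ X)
ones-⋢-π zero    0 x _ (_ ∷ () ∷ _)
ones-⋢-π zero    1 x _ (() ∷ _)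
ones-⋢-π zero    (suc (suc m)) x (s≤s ())
ones-⋢-π (suc q) 0 x _ (_ ∷ () ∷ _)
ones-⋢-π (suc q) 1 x _ (() ∷ _)
ones-⋢-π (suc q) 2 x _ (_ ∷ () ∷ _)
ones-⋢-π (suc q) 3 x _ (() ∷ _)
ones-⋢-π (suc q) (suc (suc (suc (suc m)))) x (s≤s (s≤s (s≤s (s≤s m≤)))) = ones-⋢-π q m ◇ m≤

-- The bounds place the 000 at one of |A| - 1, …, |A| + 3, so it always meets a 1 of 0101.
block11-⋢-zeros : ∀ A m {R W} → length A ≤ suc m → m ≤ 3 + length A →
                  ¬ (A ++ false ∷ true ∷ false ∷ true ∷ R) ⊑ (replicate m ◇ ++ 𝟎 ∷ 𝟎 ∷ 𝟎 ∷ W)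
block11-⋢-zeros []          0 _ _ (_ ∷ () ∷ _)
block11-⋢-zeros []          1 _ _ (_ ∷ () ∷ _)
block11-⋢-zeros []          2 _ _ (_ ∷ _ ∷ _ ∷ () ∷ _)
block11-⋢-zeros []          3 _ _ (_ ∷ _ ∷ _ ∷ () ∷ _)
block11-⋢-zeros []          (suc (suc (suc (suc m)))) _ (s≤s (s≤s (s≤s ())))
block11-⋢-zeros (a ∷ [])    0 _ _ (_ ∷ _ ∷ () ∷ _)
block11-⋢-zeros (a ∷ b ∷ A) 0 (s≤s ()) _
block11-⋢-zeros (a ∷ A) (suc m) (s≤s |A|≤) (s≤s m≤) (_ ∷ A⊑) = block11-⋢-zeros A m |A|≤ m≤ A⊑

block : Bool × Bool → List Bool
block (a , b) = false ∷ a ∷ false ∷ b ∷ []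

word : List (Bool × Bool) → List Bool
word ps = true ∷ true ∷ concatMap block ps ++ false ∷ []

length-blocks : ∀ ps → length (concatMap block ps) ≡ length ps * 4
length-blocks []       = refl
length-blocks (x ∷ ps) = cong (4 +_) (length-blocks ps)

length-word : ∀ ps → length (word ps) ≡ d (length ps)
length-word ps = begin
  2 + length (concatMap block ps ++ false ∷ [])  ≡⟨ cong (2 +_) (length-++ (concatMap block ps)) ⟩
  2 + (length (concatMap block ps) + 1)          ≡⟨ cong (λ m → 2 + (m + 1)) (length-blocks ps) ⟩
  2 + (length ps * 4 + 1)                        ≡⟨ polynomial (length ps) ⟩
  d (length ps)                                  ∎
  where
  open ≡-Reasoning
  polynomial : ∀ m → 2 + (m * 4 + 1) ≡ 4 * m + 3
  polynomial = solve-∀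

word-split : ∀ ps₁ x ps₂ →
  word (ps₁ ++ x ∷ ps₂) ≡ (true ∷ true ∷ concatMap block ps₁) ++ block x ++ concatMap block ps₂ ++ false ∷ []
word-split ps₁ x ps₂ = cong (λ L → true ∷ true ∷ L)
  (trans (cong (_++ false ∷ []) (concatMap-++ block ps₁ (x ∷ ps₂))) (++-assoc (concatMap block ps₁) _ _))

head-blocks : ∀ ps → ∃ λ R → concatMap block ps ++ false ∷ [] ≡ false ∷ R
head-blocks []       = [] , refl
head-blocks (x ∷ ps) = _ , refl

≈π⇒blocks : ∀ q R → solid R ≈ₚ (pow q π ++ 𝟎 ∷ []) → ∃ λ ps → length ps ≡ q × R ≡ concatMap block ps ++ false ∷ []
≈π⇒blocks zero    (false ∷ [])             (_ ∷ [])  = [] , refl , refl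
≈π⇒blocks zero    (true ∷ _)               (() ∷ _)
≈π⇒blocks zero    (false ∷ _ ∷ _)          (_ ∷ ())
≈π⇒blocks (suc q) (true ∷ _)               (() ∷ _)
≈π⇒blocks (suc q) (false ∷ a ∷ true ∷ _)   (_ ∷ _ ∷ () ∷ _)
≈π⇒blocks (suc q) (false ∷ a ∷ false ∷ b ∷ R) (_ ∷ _ ∷ _ ∷ _ ∷ R≈) with ≈π⇒blocks q R R≈
... | ps , refl , refl = (a , b) ∷ ps , refl , refl

≈pattern⇒word : ∀ p S → solid S ≈ₚ pattern11π0 p → ∃ λ ps → length ps ≡ p × S ≡ word ps
≈pattern⇒word p (true ∷ true ∷ R) (_ ∷ _ ∷ R≈) with ≈π⇒blocks p R R≈
... | ps , |ps|≡ , refl = ps , |ps|≡ , refl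
≈pattern⇒word p (false ∷ _)        (() ∷ _)
≈pattern⇒word p (true ∷ false ∷ _) (_ ∷ () ∷ _)

blocks-⊑-π : ∀ q ps {X} → length ps ≡ suc q →
             (concatMap block ps ++ false ∷ []) ⊑ (pow q π ++ 𝟎 ∷ ◇ ∷ ◇ ∷ ◇ ∷ ◇ ∷ X)
blocks-⊑-π zero    (x ∷ [])    refl  = refl0 ∷ holeʳ ∷ holeʳ ∷ holeʳ ∷ holeʳ ∷ []
blocks-⊑-π (suc q) (x ∷ ps)    |ps|≡ = refl0 ∷ holeʳ ∷ refl0 ∷ holeʳ ∷ blocks-⊑-π q ps (suc-injective |ps|≡)
blocks-⊑-π zero    (x ∷ _ ∷ _) ()
blocks-⊑-π _       []          ()

-- β (suc q) (suc J) has a gap of length 4 (J + 1) + 1, written here as 5 + n with n = 4 J.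
βtail : ℕ → ℕ → PWord
βtail q n = replicate (5 + n) ◇ ++ 𝟎 ∷ 𝟎 ∷ 𝟎 ∷ replicate (d (suc q)) ◇

β′ : ℕ → ℕ → PWord
β′ q n = 𝟏 ∷ 𝟏 ∷ pow q π ++ 𝟎 ∷ βtail q n

gapStart : ℕ → ℕ
gapStart q = 2 + (q * 4 + 1)

β≡β′ : ∀ q ps → β (suc q) (suc (length ps)) ≡ β′ q (length (concatMap block ps))
β≡β′ q ps = cong (λ m → 𝟏 ∷ 𝟏 ∷ pow q π ++ 𝟎 ∷ replicate m ◇ ++ 𝟎 ∷ 𝟎 ∷ 𝟎 ∷ replicate (d (suc q)) ◇)
  (trans (polynomial (length ps)) (cong (5 +_) (sym (length-blocks ps))))
  where
  polynomial : ∀ J → 4 * suc J + 1 ≡ 5 + J * 4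
  polynomial = solve-∀

drop-pow-π : ∀ q y V → drop (q * 4 + y) (pow q π ++ V) ≡ drop y V
drop-pow-π zero    y V = refl
drop-pow-π (suc q) y V = drop-pow-π q y V

drop-β′ : ∀ q n t → drop (gapStart q + t) (β′ q n) ≡ drop t (βtail q n)
drop-β′ q n t = trans (sym (drop-drop (gapStart q) t (β′ q n))) (cong (drop t) (drop-pow-π q 1 _))

drop-β′-end : ∀ q n → drop (gapStart q + (5 + n + 3)) (β′ q n) ≡ replicate (d (suc q)) ◇
drop-β′-end q n = trans (drop-β′ q n (5 + n + 3)) (drop-replicate-++ (5 + n) 3 _)

length-β′ : ∀ q n → length (β′ q n) ≡ gapStart q + (5 + n + 3) + d (suc q)
length-β′ q n = begin
  length (β′ q n)                                              ≡⟨ length-via-drop (gapStart q + (5 + n + 3)) (β′ q n) (drop-β′-end q n) ⟩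
  gapStart q + (5 + n + 3) + length (replicate (d (suc q)) ◇)  ≡⟨ cong (gapStart q + (5 + n + 3) +_) (length-replicate (d (suc q))) ⟩
  gapStart q + (5 + n + 3) + d (suc q)                          ∎
  where open ≡-Reasoning

d≡gapStart+4 : ∀ q → d (suc q) ≡ gapStart q + 4
d≡gapStart+4 = polynomial
  where
  polynomial : ∀ q → 4 * suc q + 3 ≡ 2 + (q * 4 + 1) + 4
  polynomial = solve-∀

d<length-β′ : ∀ q n → d (suc q) < length (β′ q n)
d<length-β′ q n = begin-strict
  d (suc q)                             ≡⟨ d≡gapStart+4 q ⟩
  gapStart q + 4                        ≤⟨ +-monoʳ-≤ (gapStart q) (s≤s (s≤s (s≤s (s≤s z≤n)))) ⟩
  gapStart q + (5 + n + 3)              <⟨ m<m+n (gapStart q + (5 + n + 3)) (s≤s z≤n) ⟩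
  gapStart q + (5 + n + 3) + d (suc q)  ≡⟨ sym (length-β′ q n) ⟩
  length (β′ q n)                       ∎
  where open ≤-Reasoning

gapEnd≤ : ∀ q n t → n ≤ q * 4 → 1 ≤ t → gapStart q + (5 + n + 3) ≤ gapStart q + t + (gapStart q + 4)
gapEnd≤ q n t n≤ 1≤t = begin
  g + (5 + n + 3)    ≡⟨ polynomial₁ g n ⟩
  (4 + n) + (g + 4)  ≤⟨ +-monoˡ-≤ (g + 4) 4+n≤g+t ⟩
  g + t + (g + 4)    ∎
  where
  open ≤-Reasoning
  g = gapStart q
  polynomial₁ : ∀ g n → g + (5 + n + 3) ≡ (4 + n) + (g + 4)
  polynomial₁ = solve-∀
  polynomial₂ : ∀ q → 4 + q * 4 ≡ 2 + (q * 4 + 1) + 1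
  polynomial₂ = solve-∀
  4+n≤g+t : 4 + n ≤ g + t
  4+n≤g+t = begin
    4 + n      ≤⟨ +-monoʳ-≤ 4 n≤ ⟩
    4 + q * 4  ≡⟨ polynomial₂ q ⟩
    g + 1      ≤⟨ +-monoʳ-≤ g 1≤t ⟩
    g + t      ∎

CoveredFrom : List Bool → PWord → ℕ → Set
CoveredFrom S T m = ∀ i → m ≤ i → i < length T → ∃ λ k → k ≤ i × i < k + length S × OccursAt S T k

coveredFrom-≥length : ∀ {S T m} → length T ≤ m → CoveredFrom S T m
coveredFrom-≥length |T|≤m i m≤i i<|T| = ⊥-elim (<-irrefl refl (<-≤-trans i<|T| (≤-trans |T|≤m m≤i)))

coveredFrom-occurrence : ∀ {S T k m} → OccursAt S T k → k ≤ m → CoveredFrom S T (k + length S) → CoveredFrom S T m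
coveredFrom-occurrence {S} {k = k} occ k≤m rest i m≤i i<|T| with i <? k + length S
... | yes i<end = k , ≤-trans k≤m m≤i , i<end , occ
... | no  i≮end = rest i (≮⇒≥ i≮end) i<|T|

¬covers-β′ : ∀ q C R {S} → S ≡ (true ∷ true ∷ C) ++ block (true , true) ++ R → length S ≡ d (suc q) →
             ¬ Covers S (β′ q (length C))
¬covers-β′ q C R {S} refl |S|≡ cover =
  noOccurrence (cover (length S) (subst (_< length T) (sym |S|≡) (d<length-β′ q n)))
  where
  n = length C
  T = β′ q n
  noOccurrence : ¬ (∃ λ k → k ≤ length S × length S < k + length S × S ⊑ drop k T)
  noOccurrence (k , k≤|S| , |S|<k+|S| , S⊑) with gapStart q ≤? k
  ... | no k≱g = beforeGap k (≰⇒> k≱g) |S|<k+|S| S⊑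
    where
    beforeGap : ∀ k → k < gapStart q → length S < k + length S → ¬ S ⊑ drop k T
    beforeGap zero    _                |S|<|S| _ = <-irrefl refl |S|<|S|
    beforeGap (suc m) (s≤s (s≤s m≤)) _         = ones-⋢-π q m 𝟏 m≤
  ... | yes g≤k = block11-⋢-zeros (true ∷ true ∷ C) (5 + n ∸ t)
                    (s≤s (∸-monoʳ-≤ (5 + n) t≤4)) (m∸n≤m (5 + n) t) (subst (S ⊑_) window S⊑)
    where
    t = k ∸ gapStart q
    t≤4 : t ≤ 4
    t≤4 = ≤-trans (∸-monoˡ-≤ (gapStart q) k≤|S|)
            (≤-reflexive (trans (cong (_∸ gapStart q) (trans |S|≡ (d≡gapStart+4 q))) (m+n∸m≡n (gapStart q) 4)))
    window : drop k T ≡ replicate (5 + n ∸ t) ◇ ++ 𝟎 ∷ 𝟎 ∷ 𝟎 ∷ replicate (d (suc q)) ◇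
    window = begin
      drop k T                 ≡⟨ cong (λ i → drop i T) (sym (m+[n∸m]≡n g≤k)) ⟩
      drop (gapStart q + t) T  ≡⟨ drop-β′ q n t ⟩
      drop t (βtail q n)       ≡⟨ drop-replicate-++-≤ _ (≤-trans t≤4 (s≤s (s≤s (s≤s (s≤s z≤n))))) ⟩
      replicate (5 + n ∸ t) ◇ ++ 𝟎 ∷ 𝟎 ∷ 𝟎 ∷ replicate (d (suc q)) ◇ ∎
      where open ≡-Reasoning

block-zeros-occurrence : ∀ q C x R {S} → S ≡ (true ∷ true ∷ C) ++ block x ++ false ∷ R → x ≢ (true , true) →
  length S ≡ d (suc q) → ∃ λ t → 1 ≤ t × t ≤ 3 × OccursAt S (β′ q (length C)) (gapStart q + t)
block-zeros-occurrence q C (false , b) R refl _ |S|≡ =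
  3 , s≤s z≤n , ≤-refl ,
  subst (((true ∷ true ∷ C) ++ block (false , b) ++ false ∷ R) ⊑_) (sym (drop-β′ q (length C) 3))
    (⊑-zeros (true ∷ true ∷ C) refl (≤-reflexive |S|≡))
block-zeros-occurrence q C (true , false) R refl _ |S|≡ =
  1 , ≤-refl , s≤s z≤n ,
  subst₂ _⊑_ reassoc (sym (drop-β′ q (length C) 1))
    (⊑-zeros A (cong (2 +_) (trans (length-++ C) (+-comm (length C) 2)))
              (≤-reflexive (trans (cong length reassoc) |S|≡)))
  where
  A = true ∷ true ∷ C ++ false ∷ true ∷ []
  reassoc : A ++ false ∷ false ∷ false ∷ R ≡ (true ∷ true ∷ C) ++ block (true , false) ++ false ∷ R
  reassoc = ++-assoc (true ∷ true ∷ C) (false ∷ true ∷ []) _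
block-zeros-occurrence q C (true , true) R _ x≢11 _ = ⊥-elim (x≢11 refl)

covers-β′ : ∀ q ps₁ x ps₂ → length (ps₁ ++ x ∷ ps₂) ≡ suc q → x ≢ (true , true) →
            Covers (word (ps₁ ++ x ∷ ps₂)) (β′ q (length (concatMap block ps₁)))
covers-β′ q ps₁ x ps₂ |ps|≡ x≢11 with head-blocks ps₂
... | R , R≡ = coveredVia (block-zeros-occurrence q C x R S≡ x≢11 |S|≡)
  where
  C = concatMap block ps₁
  n = length C
  g = gapStart q
  S = word (ps₁ ++ x ∷ ps₂)
  T = β′ q n
  S≡ : S ≡ (true ∷ true ∷ C) ++ block x ++ false ∷ R
  S≡ = trans (word-split ps₁ x ps₂) (cong (λ L → (true ∷ true ∷ C) ++ block x ++ L) R≡)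
  |S|≡ : length S ≡ d (suc q)
  |S|≡ = trans (length-word (ps₁ ++ x ∷ ps₂)) (cong d |ps|≡)
  g+4≡|S| : g + 4 ≡ length S
  g+4≡|S| = sym (trans |S|≡ (d≡gapStart+4 q))
  n≤ : n ≤ q * 4
  n≤ = subst (_≤ q * 4) (sym (length-blocks ps₁))
         (*-monoˡ-≤ 4 (≤-pred (subst (length ps₁ <_) |ps|≡ (length-prefix-< ps₁))))
  atStart : OccursAt S T 0
  atStart = refl1 ∷ refl1 ∷ blocks-⊑-π q (ps₁ ++ x ∷ ps₂) |ps|≡
  atEnd : OccursAt S T (g + (5 + n + 3))
  atEnd = subst (S ⊑_) (sym (drop-β′-end q n)) (⊑-◇ S (≤-reflexive |S|≡))
  coveredVia : (∃ λ t → 1 ≤ t × t ≤ 3 × OccursAt S T (g + t)) → Covers S T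
  coveredVia (t , 1≤t , t≤3 , inGap) i =
    coveredFrom-occurrence atStart z≤n
      (coveredFrom-occurrence inGap (≤-trans (+-monoʳ-≤ g (≤-trans t≤3 (n≤1+n 3))) (≤-reflexive g+4≡|S|))
        (coveredFrom-occurrence atEnd (subst (λ ℓ → g + (5 + n + 3) ≤ g + t + ℓ) g+4≡|S| (gapEnd≤ q n t n≤ 1≤t))
          (coveredFrom-≥length (≤-reflexive (trans (length-β′ q n) (cong (g + (5 + n + 3) +_) (sym |S|≡)))))))
      i z≤n

covers-β⇔ : ∀ q ps₁ x ps₂ → length (ps₁ ++ x ∷ ps₂) ≡ suc q →
            Covers (word (ps₁ ++ x ∷ ps₂)) (β (suc q) (suc (length ps₁))) ⇔ x ≢ (true , true)
covers-β⇔ q ps₁ x ps₂ |ps|≡ =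
  subst (λ T → Covers (word (ps₁ ++ x ∷ ps₂)) T ⇔ x ≢ (true , true)) (sym (β≡β′ q ps₁))
    (mk⇔ blockNot11 (covers-β′ q ps₁ x ps₂ |ps|≡))
  where
  blockNot11 : Covers (word (ps₁ ++ x ∷ ps₂)) (β′ q (length (concatMap block ps₁))) → x ≢ (true , true)
  blockNot11 cover refl = ¬covers-β′ q (concatMap block ps₁) (concatMap block ps₂ ++ false ∷ [])
                      (word-split ps₁ x ps₂) (trans (length-word (ps₁ ++ x ∷ ps₂)) (cong d |ps|≡)) cover

CoversEveryβ : ℕ → List Bool → Set
CoversEveryβ p S = ∀ j → 1 ≤ j → j ≤ p → Covers S (β p j)

coversEveryβ⇔ : ∀ q ps → length ps ≡ suc q → CoversEveryβ (suc q) (word ps) ⇔ All (_≢ (true , true)) ps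
coversEveryβ⇔ q ps |ps|≡ = mk⇔ (λ cover → All.tabulate (λ x∈ps → blockOk cover (∈-∃++ x∈ps))) (coverAt ps |ps|≡)
  where
  blockOk : ∀ {x} → CoversEveryβ (suc q) (word ps) → (∃₂ λ ps₁ ps₂ → ps ≡ ps₁ ++ x ∷ ps₂) → x ≢ (true , true)
  blockOk {x} cover (ps₁ , ps₂ , ps≡) = Equivalence.to (covers-β⇔ q ps₁ x ps₂ |ps₁xps₂|≡)
    (subst (λ ps → Covers (word ps) (β (suc q) (suc (length ps₁)))) ps≡
      (cover (suc (length ps₁)) (s≤s z≤n) (subst (length ps₁ <_) |ps₁xps₂|≡ (length-prefix-< ps₁))))
    where
    |ps₁xps₂|≡ : length (ps₁ ++ x ∷ ps₂) ≡ suc q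
    |ps₁xps₂|≡ = trans (cong length (sym ps≡)) |ps|≡
  coverAt : ∀ ps → length ps ≡ suc q → All (_≢ (true , true)) ps → CoversEveryβ (suc q) (word ps)
  coverAt ps |ps|≡ ok (suc J) _ j≤ with split-at ps J (subst (J <_) (sym |ps|≡) j≤)
  ... | ps₁ , x , ps₂ , refl , refl = Equivalence.from (covers-β⇔ q ps₁ x ps₂ |ps|≡) (All.head (++⁻ʳ ps₁ ok))

hBits : PSym → Bool × Bool
hBits 𝟎 = true , false
hBits 𝟏 = false , true
hBits ◇ = false , false

h≡block∘hBits : ∀ v → h v ≡ block (hBits v)
h≡block∘hBits 𝟎 = refl
h≡block∘hBits 𝟏 = refl
h≡block∘hBits ◇ = refl

word∘map-hBits : ∀ V → word (map hBits V) ≡ true ∷ true ∷ hWord V ++ false ∷ []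
word∘map-hBits V = cong (λ L → true ∷ true ∷ L ++ false ∷ [])
  (trans (concatMap-map block hBits V) (sym (concatMap-cong h≡block∘hBits V)))

hBits≢11 : ∀ v → hBits v ≢ (true , true)
hBits≢11 𝟎 ()
hBits≢11 𝟏 ()
hBits≢11 ◇ ()

map-hBits-onto : ∀ {ps} → All (_≢ (true , true)) ps → ∃ λ V → map hBits V ≡ ps
map-hBits-onto []                          = [] , refl
map-hBits-onto {(true , false) ∷ _}  (_ ∷ ok) with map-hBits-onto ok
... | V , refl = 𝟎 ∷ V , refl
map-hBits-onto {(false , true) ∷ _}  (_ ∷ ok) with map-hBits-onto ok
... | V , refl = 𝟏 ∷ V , refl
map-hBits-onto {(false , false) ∷ _} (_ ∷ ok) with map-hBits-onto ok
... | V , refl = ◇ ∷ V , refl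
map-hBits-onto {(true , true) ∷ _}   (x≢11 ∷ _) = ⊥-elim (x≢11 refl)

HImage : ℕ → List Bool → Set
HImage p S = ∃ λ (V : PWord) → length V ≡ p × S ≡ true ∷ true ∷ hWord V ++ false ∷ []

coversEveryβ⇔HImage : ∀ q ps → length ps ≡ suc q → CoversEveryβ (suc q) (word ps) ⇔ HImage (suc q) (word ps)
coversEveryβ⇔HImage q ps |ps|≡ =
  mk⇔ (λ cover → preimage (map-hBits-onto (Equivalence.to (coversEveryβ⇔ q ps |ps|≡) cover))) image
  where
  preimage : (∃ λ V → map hBits V ≡ ps) → HImage (suc q) (word ps)
  preimage (V , V↦ps) = V , trans (sym (length-map hBits V)) (trans (cong length V↦ps) |ps|≡) ,
                        trans (cong word (sym V↦ps)) (word∘map-hBits V)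
  image : HImage (suc q) (word ps) → CoversEveryβ (suc q) (word ps)
  image (V , |V|≡ , ps↦V) =
    subst (CoversEveryβ (suc q)) (trans (word∘map-hBits V) (sym ps↦V))
      (Equivalence.from (coversEveryβ⇔ q (map hBits V) (trans (length-map hBits V) |V|≡))
        (map⁺ (All.universal hBits≢11 V)))

corollary2 : (p : ℕ) → 1 ≤ p → (S : List Bool) → solid S ≈ₚ pattern11π0 p →
    ((∀ j → 1 ≤ j → j ≤ p → Covers S (β p j)) ⇔
     (∃ λ (V : PWord) → length V ≡ p × S ≡ true ∷ true ∷ hWord V ++ false ∷ []))
corollary2 (suc q) _ S S≈ = viaWord (≈pattern⇒word (suc q) S S≈)
  where
  viaWord : (∃ λ ps → length ps ≡ suc q × S ≡ word ps) → CoversEveryβ (suc q) S ⇔ HImage (suc q) S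
  viaWord (ps , |ps|≡ , S≡) =
    subst (λ S → CoversEveryβ (suc q) S ⇔ HImage (suc q) S) (sym S≡) (coversEveryβ⇔HImage q ps |ps|≡)
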